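{- Let $G$ be a complete wheel with $n\geq6$ vertices, cycle $C=\{c_1,\dots,c_{n-1}\}$ and central vertex $h$, $V=C\cup\{h\}$, and let $w:V\to\mathbb{Q}^+$. Then $md_k^{AP}(G)=\infty$ for every $k\geq5$. Additionally, if $n\geq7$ then $md_4^{AP}(G)=n-1$ and $wmd_4^{AP}(G)=w(C)$, and if $n=6$ then $md_4^{AP}(G)=6$ and $wmd_4^{AP}(G)=w(V)$.
   Context: The complete wheel on $n$ vertices has vertex set $V=C\cup\{h\}$ with $C=\{c_1,\dots,c_{n-1}\}$, edges $\{c_i,h\}$ and $\{c_i,c_{i+1}\}$ for $1\le i\le n-1$, indices modulo $n-1$. $d(x,y)$ denotes graph distance; $\tau$ separates distinct $u,v$ if $d(u,\tau)\neq d(v,\tau)$. $L\subseteq V$ is an AP-landmark set for parameter $k$ if every pair of distinct $u,v\in V$ is separated by at least $k$ distinct vertices of $L$. $md_k^{AP}(G)$ is the minimum cardinality and $wmd_k^{AP}(G)$ the minimum of $w(L)=\sum_{v\in L}w(v)$ over such sets ($\infty$ if none exists). -}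

module Defs where

open import Data.Bool using (Bool; true; false; _∧_; _∨_; not; if_then_else_)
open import Data.Nat using (ℕ; zero; suc; _≡ᵇ_; _∸_; _≤_)
open import Data.Fin using (Fin; toℕ)
open import Data.Fin.Subset using (Subset; _∩_; ∣_∣; ⊤)
open import Data.List using (List; foldr; map; allFin)
open import Data.Bool.ListAction using (any)
open import Data.Vec using (tabulate; lookup)
open import Data.Rational using (ℚ; 0ℚ; _+_)
import Data.Rational as ℚ
open import Relation.Binary.PropositionalEquality using (_≡_; _≢_)
open import Data.Product using (Σ; _×_)
open import Data.Empty using (⊥)

module GraphDist {N : ℕ} (adj : Fin N → Fin N → Bool) where

  reach : ℕ → Fin N → Fin N → Bool
  reach zero    x y = toℕ x ≡ᵇ toℕ y
  reach (suc k) x y = reach k x y ∨ any (λ z → adj x z ∧ reach k z y) (allFin N)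

  -- least k (searching k = start, start+1, ...) with reach k x y;
  -- the value N means "unreachable" (every finite distance is < N)
  distAux : Fin N → Fin N → ℕ → ℕ → ℕ
  distAux x y k zero     = k
  distAux x y k (suc f)  = if reach k x y then k else distAux x y (suc k) f

  dist : Fin N → Fin N → ℕ
  dist x y = distAux x y 0 N

-- The complete wheel on n vertices.
-- Vertex with toℕ = 0 is the hub h; vertex with toℕ = i (1 ≤ i ≤ n-1)
-- is the cycle vertex c_i.

isHub : {n : ℕ} → Fin n → Bool
isHub x = toℕ x ≡ᵇ 0

cycAdj : ℕ → ℕ → ℕ → Bool
cycAdj n a b = (suc a ≡ᵇ b) ∨ (suc b ≡ᵇ a)
             ∨ ((a ≡ᵇ 1) ∧ (b ≡ᵇ (n ∸ 1)))
             ∨ ((b ≡ᵇ 1) ∧ (a ≡ᵇ (n ∸ 1)))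

wheelAdj : (n : ℕ) → Fin n → Fin n → Bool
wheelAdj n x y =
     (isHub x ∧ not (isHub y))
  ∨ (isHub y ∧ not (isHub x))
  ∨ (not (isHub x) ∧ not (isHub y) ∧ cycAdj n (toℕ x) (toℕ y))

d : (n : ℕ) → Fin n → Fin n → ℕ
d n = GraphDist.dist (wheelAdj n)

cycleSet : (n : ℕ) → Subset n
cycleSet n = tabulate (λ x → not (isHub x))

sepSet : (n : ℕ) → Fin n → Fin n → Subset n
sepSet n u v = tabulate (λ τ → not (d n u τ ≡ᵇ d n v τ))

IsAPLandmark : (n : ℕ) → ℕ → Subset n → Set
IsAPLandmark n k L = (u v : Fin n) → u ≢ v → k ≤ ∣ L ∩ sepSet n u v ∣

weight : {n : ℕ} → (Fin n → ℚ) → Subset n → ℚ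
weight {n} w L = foldr _+_ 0ℚ (map (λ i → if lookup L i then w i else 0ℚ) (allFin n))

MdInfinite : (n : ℕ) → ℕ → Set
MdInfinite n k = (L : Subset n) → IsAPLandmark n k L → ⊥

MdEquals : (n : ℕ) → ℕ → ℕ → Set
MdEquals n k c =
  Σ (Subset n) (λ L → IsAPLandmark n k L × ∣ L ∣ ≡ c)
  × ((L : Subset n) → IsAPLandmark n k L → c ≤ ∣ L ∣)

WmdEquals : (n : ℕ) → (Fin n → ℚ) → ℕ → ℚ → Set
WmdEquals n w k q =
  Σ (Subset n) (λ L → IsAPLandmark n k L × weight w L ≡ q)
  × ((L : Subset n) → IsAPLandmark n k L → q ℚ.≤ weight w L)

module Submission where

-- Since h is adjacent to every vertex, d(x,y) is 0, 1 or 2 according as x = y, x ~ y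
-- or neither; so a vertex t ∉ {u, v} separates u and v iff its adjacency to them differs.  A rim edge {c, c⁺} is separated only by c, c⁺, c⁻ and c⁺⁺.  Hence no
--   set separates every pair by five vertices (md_k = ∞ for k ≥ 5), and every
--   4-landmark set contains each of these four, in particular every rim vertex.  For
--   n = 6 the pair {h, c₁} is likewise separated only by h, c₁, c₃, c₄ (a finite
--   computation), so there the hub is forced as well.  Every pair of distinct vertices has four separators on the rim when
--   n ≥ 7, and four separators in V when n ≥ 6; they are written down explicitly in
--   terms of the cyclic successor σ of the rim.
-- A k-landmark set S contained in every k-landmark set realises md_k = ∣S∣ and, for
-- positive weights, wmd_k = w(S); this gives the theorem with S = C (n ≥ 7) and S = V
-- (n = 6).

open import Defs
open import Data.Bool using (Bool; true; false; T; _∧_; _∨_; not; if_then_else_)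
open import Data.Bool.Properties using (T-≡; T-∧; T-∨; ∨-zeroʳ; ∨-comm)
open import Data.Bool.ListAction using (any)
open import Data.Empty using (⊥; ⊥-elim)
open import Data.Fin using (Fin; toℕ; fromℕ<) renaming (zero to fzero; suc to fsuc)
open import Data.Fin.Properties using (toℕ-injective; toℕ-fromℕ<; toℕ<n) renaming (_≟_ to _≟ᶠ_)
open import Data.Fin.Subset using (Subset; _∈_; _∉_; _⊆_; _∩_; _-_; ∣_∣; ⊤; outside; inside)
open import Data.Fin.Subset.Properties
  using (∈⊤; ∣⊤∣≡n; ⊆-antisym; p⊆q⇒∣p∣≤∣q∣; _∈?_; x∈p∩q⁺; x∈p∩q⁻; x∈p⇒∣p-x∣<∣p∣; x∈p∧x≢y⇒x∈p-y;
         p─q⊆p; p─⊥≡p; Empty-unique; ∣⊥∣≡0)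
open import Data.List using (List; []; _∷_; length; foldr; map; allFin)
open import Data.List.Membership.Propositional using (lose) renaming (_∈_ to _∈ₗ_)
open import Data.List.Membership.Propositional.Properties using (∈-allFin)
open import Data.List.Relation.Unary.All using (All; []; _∷_)
import Data.List.Relation.Unary.All as All
open import Data.List.Relation.Unary.AllPairs using (AllPairs; []; _∷_)
open import Data.List.Relation.Unary.Any using (here; there; satisfied)
open import Data.List.Relation.Unary.Any.Properties using (any⁺; any⁻)
open import Data.Nat using (ℕ; zero; suc; _≡ᵇ_; _<ᵇ_; _∸_; _+_; _≤_; _<_; z≤n; s≤s; _≟_; _<?_)
open import Data.Nat.Properties
open import Data.Product using (∃-syntax; _×_; _,_; proj₁; proj₂)
open import Data.Rational using (ℚ; 0ℚ; Positive)
import Data.Rational as ℚ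
import Data.Rational.Properties as ℚ
open import Data.Sum using (_⊎_; inj₁; inj₂)
open import Data.Vec using ([]; _∷_; here; there; lookup; tabulate)
open import Data.Vec.Properties using (lookup∘tabulate; lookup⇒[]=; []=⇒lookup)
open import Function using (Equivalence; _∘_)
open import Relation.Nullary using (¬_; Dec; yes; no; contradiction)
open import Relation.Nullary.Decidable using (dec-true; dec-false; _⊎-dec_)
open import Relation.Binary.PropositionalEquality
open ≡-Reasoning

≡ᵇ-refl : ∀ m → (m ≡ᵇ m) ≡ true
≡ᵇ-refl m = dec-true (m ≟ m) refl

≡ᵇ-false : ∀ {m n} → m ≢ n → (m ≡ᵇ n) ≡ false
≡ᵇ-false {m} {n} = dec-false (m ≟ n)

∨-trueˡ : ∀ {a} b → a ≡ true → a ∨ b ≡ true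
∨-trueˡ b refl = refl

∨-trueʳ : ∀ a {b} → b ≡ true → a ∨ b ≡ true
∨-trueʳ a refl = ∨-zeroʳ a

∨-swap : ∀ x y z → x ∨ (y ∨ z) ≡ y ∨ (x ∨ z)
∨-swap true  y z = sym (∨-zeroʳ y)
∨-swap false y z = refl

Named : ∀ {n} → Subset n → ℕ → Set
Named p t = ∃[ τ ] toℕ τ ≡ t × τ ∈ p

∣p∣≤1+∣p-x∣ : ∀ {n} (p : Subset n) x → ∣ p ∣ ≤ suc ∣ p - x ∣
∣p∣≤1+∣p-x∣ (inside  ∷ p) fzero    = s≤s (≤-reflexive (cong ∣_∣ (sym (p─⊥≡p p))))
∣p∣≤1+∣p-x∣ (outside ∷ p) fzero    = ≤-trans (≤-reflexive (cong ∣_∣ (sym (p─⊥≡p p)))) (n≤1+n _)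
∣p∣≤1+∣p-x∣ (inside  ∷ p) (fsuc x) = s≤s (∣p∣≤1+∣p-x∣ p x)
∣p∣≤1+∣p-x∣ (outside ∷ p) (fsuc x) = ∣p∣≤1+∣p-x∣ p x

x∉p-x : ∀ {n} (p : Subset n) x → x ∉ p - x
x∉p-x (s ∷ p) fzero    ()
x∉p-x (s ∷ p) (fsuc x) (there x∈) = x∉p-x p x x∈

∣p∣≤length : ∀ {n} (p : Subset n) ts → (∀ {τ} → τ ∈ p → toℕ τ ∈ₗ ts) → ∣ p ∣ ≤ length ts
∣p∣≤length {n} p [] named = ≤-reflexive (trans (cong ∣_∣ (Empty-unique empty)) (∣⊥∣≡0 n))
  where
  empty : ¬ (∃[ τ ] τ ∈ p)
  empty (τ , τ∈p) with named τ∈p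
  ... | ()
∣p∣≤length {n} p (t ∷ ts) named with t <? n
... | yes t<n = ≤-trans (∣p∣≤1+∣p-x∣ p x) (s≤s (∣p∣≤length (p - x) ts named′))
  where
  x : Fin n
  x = fromℕ< t<n
  named′ : ∀ {τ} → τ ∈ p - x → toℕ τ ∈ₗ ts
  named′ {τ} τ∈ with named (p─q⊆p p _ τ∈)
  ... | here τ≡t = contradiction (subst (_∈ p - x) (toℕ-injective (trans τ≡t (sym (toℕ-fromℕ< t<n)))) τ∈) (x∉p-x p x)
  ... | there τ∈ts = τ∈ts
... | no t≮n = ≤-trans (∣p∣≤length p ts named′) (n≤1+n _)
  where
  named′ : ∀ {τ} → τ ∈ p → toℕ τ ∈ₗ ts
  named′ {τ} τ∈p with named τ∈p
  ... | here τ≡t = contradiction (subst (_< n) τ≡t (toℕ<n τ)) t≮n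
  ... | there τ∈ts = τ∈ts

length≤∣p∣ : ∀ {n} (p : Subset n) {ts} → AllPairs _≢_ ts → All (Named p) ts → length ts ≤ ∣ p ∣
length≤∣p∣ p [] [] = z≤n
length≤∣p∣ p (t≢ts ∷ distinct) ((τ , refl , τ∈p) ∷ named) =
  ≤-trans (s≤s (length≤∣p∣ (p - τ) distinct (All.zipWith rename (t≢ts , named)))) (x∈p⇒∣p-x∣<∣p∣ τ∈p)
  where
  rename : ∀ {t} → toℕ τ ≢ t × Named p t → Named (p - τ) t
  rename (t≢ , (τ′ , refl , τ′∈p)) = τ′ , refl , x∈p∧x≢y⇒x∈p-y τ′∈p (λ τ′≡τ → t≢ (cong toℕ (sym τ′≡τ)))

landmark-bound : ∀ {n k L u v} ts → IsAPLandmark n k L → u ≢ v →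
                 (∀ {τ} → τ ∈ sepSet n u v → toℕ τ ∈ₗ ts) → k ≤ length ts
landmark-bound {n} {L = L} {u} {v} ts isL u≢v named =
  ≤-trans (isL u v u≢v) (∣p∣≤length (L ∩ sepSet n u v) ts (named ∘ proj₂ ∘ x∈p∩q⁻ L _))

forced : ∀ {n L u v} x ts → IsAPLandmark n (suc (length ts)) L → u ≢ v →
         (∀ {τ} → τ ∈ sepSet n u v → toℕ τ ∈ₗ toℕ x ∷ ts) → x ∈ L
forced {n} {L} {u} {v} x ts isL u≢v named with x ∈? L
... | yes x∈L = x∈L
... | no x∉L = ⊥-elim (<-irrefl refl (≤-trans (isL u v u≢v) (∣p∣≤length (L ∩ sepSet n u v) ts others)))
  where
  others : ∀ {τ} → τ ∈ L ∩ sepSet n u v → toℕ τ ∈ₗ ts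
  others τ∈ with x∈p∩q⁻ L _ τ∈
  ... | τ∈L , τ∈sep with named τ∈sep
  ...   | here τ≡x   = contradiction (subst (_∈ L) (toℕ-injective τ≡x) τ∈L) x∉L
  ...   | there τ∈ts = τ∈ts

contribution : ∀ {n} → (Fin n → ℚ) → Subset n → Fin n → ℚ
contribution w L i = if lookup L i then w i else 0ℚ

weight-mono : ∀ {n} (w : Fin n → ℚ) → (∀ i → 0ℚ ℚ.≤ w i) → ∀ {S L} → S ⊆ L → weight w S ℚ.≤ weight w L
weight-mono {n} w w≥0 {S} {L} S⊆L = sum-mono (allFin n)
  where
  term-mono : ∀ i → contribution w S i ℚ.≤ contribution w L i
  term-mono i with lookup S i in i∈S | lookup L i in i∈L
  ... | true  | true  = ℚ.≤-refl
  ... | false | false = ℚ.≤-refl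
  ... | false | true  = w≥0 i
  ... | true  | false = contradiction (trans (sym ([]=⇒lookup (S⊆L (lookup⇒[]= i S i∈S)))) i∈L) λ ()
  sum-mono : ∀ is → foldr ℚ._+_ 0ℚ (map (contribution w S) is) ℚ.≤ foldr ℚ._+_ 0ℚ (map (contribution w L) is)
  sum-mono []       = ℚ.≤-refl
  sum-mono (i ∷ is) = ℚ.+-mono-≤ (term-mono i) (sum-mono is)

least-landmark : ∀ {n k} (w : Fin n → ℚ) → (∀ v → Positive (w v)) → ∀ S → IsAPLandmark n k S →
                 (∀ L → IsAPLandmark n k L → S ⊆ L) → MdEquals n k ∣ S ∣ × WmdEquals n w k (weight w S)
least-landmark w pos S isS least =
    ((S , isS , refl) , λ L isL → p⊆q⇒∣p∣≤∣q∣ (least L isL))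
  , ((S , isS , refl) , λ L isL → weight-mono w w≥0 (least L isL))
  where
  w≥0 : ∀ i → 0ℚ ℚ.≤ w i
  w≥0 i = ℚ.nonNegative⁻¹ (w i) {{ℚ.pos⇒nonNeg (w i) {{pos i}}}}

-- Distance in a graph on at least three vertices having a vertex h adjacent to
-- every other vertex: such a graph has diameter at most 2.
module UniversalVertex {N : ℕ} (adj : Fin (3 + N) → Fin (3 + N) → Bool) (h : Fin (3 + N))
    (h-adj : ∀ {y} → y ≢ h → adj h y ≡ true) (adj-h : ∀ {x} → x ≢ h → adj x h ≡ true) where

  open GraphDist adj

  reach-1 : ∀ x y → reach 1 x y ≡ (toℕ x ≡ᵇ toℕ y) ∨ adj x y
  reach-1 x y = cong ((toℕ x ≡ᵇ toℕ y) ∨_) any-edge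
    where
    step : Fin (3 + N) → Bool
    step z = adj x z ∧ reach 0 z y
    any-edge : any step (allFin _) ≡ adj x y
    any-edge with adj x y in edge | any step (allFin _) in found
    ... | true  | true  = refl
    ... | false | false = refl
    ... | true  | false = ⊥-elim (subst T found (any⁺ step (lose (∈-allFin y) y-step)))
      where
      y-step : T (step y)
      y-step rewrite edge | ≡ᵇ-refl (toℕ y) = _
    ... | false | true with satisfied (any⁻ step (allFin _) (subst T (sym found) _))
    ...   | z , z-step with Equivalence.to T-∧ z-step
    ...     | x~z , z≡y with toℕ-injective (≡ᵇ⇒≡ (toℕ z) (toℕ y) z≡y)
    ...       | refl = ⊥-elim (subst T edge x~z)

  reach-1-h : ∀ y → reach 1 h y ≡ true
  reach-1-h y with h ≟ᶠ y
  ... | yes refl = ∨-trueˡ _ (≡ᵇ-refl (toℕ h))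
  ... | no h≢y = trans (reach-1 h y) (∨-trueʳ _ (h-adj (h≢y ∘ sym)))

  reach-2 : ∀ x y → reach 2 x y ≡ true
  reach-2 x y with x ≟ᶠ h
  ... | yes refl = ∨-trueˡ _ (reach-1-h y)
  ... | no x≢h = ∨-trueʳ (reach 1 x y) (Equivalence.to T-≡ (any⁺ (λ z → adj x z ∧ reach 1 z y) (lose (∈-allFin h) h-step)))
    where
    h-step : T (adj x h ∧ reach 1 h y)
    h-step rewrite adj-h x≢h | reach-1-h y = _

  search-hit : ∀ x y k f → reach k x y ≡ true → distAux x y k (suc f) ≡ k
  search-hit x y k f hit = cong (λ b → if b then k else distAux x y (suc k) f) hit

  search-miss : ∀ x y k f → reach k x y ≡ false → distAux x y k (suc f) ≡ distAux x y (suc k) f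
  search-miss x y k f miss = cong (λ b → if b then k else distAux x y (suc k) f) miss

  dist-cases : ∀ x y b c → (toℕ x ≡ᵇ toℕ y) ≡ b → adj x y ≡ c →
               dist x y ≡ (if b then 0 else if c then 1 else 2)
  dist-cases x y true  _     same edge = search-hit x y 0 (2 + N) same
  dist-cases x y false true  same edge = begin
    dist x y              ≡⟨ search-miss x y 0 (2 + N) same ⟩
    distAux x y 1 (2 + N) ≡⟨ search-hit x y 1 (1 + N) (trans (reach-1 x y) (cong₂ _∨_ same edge)) ⟩
    1                     ∎
  dist-cases x y false false same edge = begin
    dist x y              ≡⟨ search-miss x y 0 (2 + N) same ⟩
    distAux x y 1 (2 + N) ≡⟨ search-miss x y 1 (1 + N) (trans (reach-1 x y) (cong₂ _∨_ same edge)) ⟩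
    distAux x y 2 (1 + N) ≡⟨ search-hit x y 2 N (reach-2 x y) ⟩
    2                     ∎

  dist-formula : ∀ x y → dist x y ≡ (if toℕ x ≡ᵇ toℕ y then 0 else if adj x y then 1 else 2)
  dist-formula x y = dist-cases x y _ _ refl refl

hub-adj : ∀ {n} {y : Fin (suc n)} → y ≢ fzero → wheelAdj (suc n) fzero y ≡ true
hub-adj {y = y} y≢hub rewrite ≡ᵇ-false (y≢hub ∘ toℕ-injective) = refl

adj-hub : ∀ {n} {x : Fin (suc n)} → x ≢ fzero → wheelAdj (suc n) x fzero ≡ true
adj-hub {x = x} x≢hub rewrite ≡ᵇ-false (x≢hub ∘ toℕ-injective) = refl

wheelAdjᵢ : ℕ → ℕ → ℕ → Bool
wheelAdjᵢ n a b = ((a ≡ᵇ 0) ∧ not (b ≡ᵇ 0)) ∨ ((b ≡ᵇ 0) ∧ not (a ≡ᵇ 0))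
                ∨ (not (a ≡ᵇ 0) ∧ not (b ≡ᵇ 0) ∧ cycAdj n a b)

δ : ℕ → ℕ → ℕ → ℕ
δ n a b = if a ≡ᵇ b then 0 else if wheelAdjᵢ n a b then 1 else 2

-- Wheels on at least three vertices have the hub as universal vertex.
d≡δ : ∀ {N} (x y : Fin (3 + N)) → d (3 + N) x y ≡ δ (3 + N) (toℕ x) (toℕ y)
d≡δ = UniversalVertex.dist-formula (wheelAdj _) fzero hub-adj adj-hub

δ-self : ∀ n a → δ n a a ≡ 0
δ-self n a rewrite ≡ᵇ-refl a = refl

δ-distinct : ∀ n {a b} → a ≢ b → δ n a b ≢ 0
δ-distinct n {a} {b} a≢b rewrite ≡ᵇ-false a≢b with wheelAdjᵢ n a b
... | true  = λ ()
... | false = λ ()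

δ-to-hub : ∀ n {a} → a ≢ 0 → δ n a 0 ≡ 1
δ-to-hub n a≢0 rewrite ≡ᵇ-false a≢0 = refl

δ-from-hub : ∀ n {b} → b ≢ 0 → δ n 0 b ≡ 1
δ-from-hub n b≢0 rewrite ≡ᵇ-false (b≢0 ∘ sym) | ≡ᵇ-false b≢0 = refl

δ-rim : ∀ n {a b} → a ≢ 0 → b ≢ 0 → a ≢ b → δ n a b ≡ (if cycAdj n a b then 1 else 2)
δ-rim n a≢0 b≢0 a≢b rewrite ≡ᵇ-false a≢b | ≡ᵇ-false a≢0 | ≡ᵇ-false b≢0 = refl

Separates : ℕ → ℕ → ℕ → ℕ → Set
Separates n a b t = δ n a t ≢ δ n b t

separates-sym : ∀ {n a b t} → Separates n a b t → Separates n b a t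
separates-sym sep = sep ∘ sym

separates-self : ∀ n {a b} → a ≢ b → Separates n a b a
separates-self n {a} a≢b e = δ-distinct n (a≢b ∘ sym) (trans (sym e) (δ-self n a))

separates-selfʳ : ∀ n {a b} → a ≢ b → Separates n a b b
separates-selfʳ n {a} {b} a≢b = separates-sym {n} {b} {a} (separates-self n (a≢b ∘ sym))

hub-separates-no-rim-pair : ∀ n {a b} → a ≢ 0 → b ≢ 0 → ¬ Separates n a b 0
hub-separates-no-rim-pair n a≢0 b≢0 sep = sep (trans (δ-to-hub n a≢0) (sym (δ-to-hub n b≢0)))

module _ {N : ℕ} (u v : Fin (3 + N)) where

  separation : Fin (3 + N) → Bool
  separation τ = not (d (3 + N) u τ ≡ᵇ d (3 + N) v τ)

  ∈sepSet⁺ : ∀ {τ} → Separates (3 + N) (toℕ u) (toℕ v) (toℕ τ) → τ ∈ sepSet (3 + N) u v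
  ∈sepSet⁺ {τ} sep = lookup⇒[]= τ _ (trans (lookup∘tabulate separation τ) (cong not (≡ᵇ-false sep′)))
    where
    sep′ : d (3 + N) u τ ≢ d (3 + N) v τ
    sep′ e = sep (trans (sym (d≡δ u τ)) (trans e (d≡δ v τ)))

  ∈sepSet⁻ : ∀ {τ} → τ ∈ sepSet (3 + N) u v → Separates (3 + N) (toℕ u) (toℕ v) (toℕ τ)
  ∈sepSet⁻ {τ} τ∈ e = not-true (trans (sym (lookup∘tabulate separation τ)) ([]=⇒lookup τ∈))
    where
    not-true : not (d (3 + N) u τ ≡ᵇ d (3 + N) v τ) ≢ true
    not-true rewrite d≡δ u τ | d≡δ v τ | e | ≡ᵇ-refl (δ (3 + N) (toℕ v) (toℕ τ)) = λ ()

∣cycleSet∣ : ∀ m → ∣ cycleSet (suc m) ∣ ≡ m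
∣cycleSet∣ m = begin
  ∣ cycleSet (suc m) ∣              ≡⟨⟩
  ∣ tabulate {n = m} (λ _ → true) ∣ ≡⟨ cong ∣_∣ rim≡⊤ ⟩
  ∣ ⊤ {m} ∣                         ≡⟨ ∣⊤∣≡n m ⟩
  m                                 ∎
  where
  rim≡⊤ : tabulate {n = m} (λ _ → true) ≡ ⊤
  rim≡⊤ = ⊆-antisym (λ {x} _ → ∈⊤ {x = x}) (λ {x} _ → lookup⇒[]= x (tabulate (λ _ → true)) (lookup∘tabulate (λ _ → true) x))

-- Arithmetic on the rim c₁ … c_m (indices 1 … m) of the wheel on m + 1 vertices.
module Rim (m : ℕ) where

  OnRim : ℕ → Set
  OnRim a = 1 ≤ a × a ≤ m

  rim-index : ∀ {t} → t ≢ 0 → t ≤ m → OnRim t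
  rim-index t≢0 t≤m = n≢0⇒n>0 t≢0 , t≤m

  rim≢hub : ∀ {a} → OnRim a → a ≢ 0
  rim≢hub (1≤a , _) refl = <-irrefl refl 1≤a

  σ : ℕ → ℕ
  σ a = if a ≡ᵇ m then 1 else suc a

  σ-last : σ m ≡ 1
  σ-last rewrite ≡ᵇ-refl m = refl

  σ-other : ∀ {a} → a ≢ m → σ a ≡ suc a
  σ-other a≢m rewrite ≡ᵇ-false a≢m = refl

  σ-rim : ∀ {a} → OnRim a → OnRim (σ a)
  σ-rim {a} (1≤a , a≤m) with a ≟ m
  ... | yes refl rewrite σ-last = ≤-refl , ≤-trans 1≤a a≤m
  ... | no a≢m rewrite σ-other a≢m = s≤s z≤n , ≤∧≢⇒< a≤m a≢m

  σ-injective : ∀ {a b} → OnRim a → OnRim b → σ a ≡ σ b → a ≡ b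
  σ-injective {a} {b} ra rb e with a ≟ m | b ≟ m
  ... | yes a≡m | yes b≡m = trans a≡m (sym b≡m)
  ... | yes refl | no b≢m = contradiction (suc-injective (trans (sym σ-last) (trans e (σ-other b≢m)))) (rim≢hub rb ∘ sym)
  ... | no a≢m | yes refl = contradiction (suc-injective (trans (sym σ-last) (trans (sym e) (σ-other a≢m)))) (rim≢hub ra ∘ sym)
  ... | no a≢m | no b≢m = suc-injective (trans (sym (σ-other a≢m)) (trans e (σ-other b≢m)))

  σ^ : ℕ → ℕ → ℕ
  σ^ zero    a = a
  σ^ (suc i) a = σ (σ^ i a)

  σ^-rim : ∀ i {a} → OnRim a → OnRim (σ^ i a)
  σ^-rim zero    ra = ra
  σ^-rim (suc i) ra = σ-rim (σ^-rim i ra)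

  σ^-closed : ∀ i {a} → i ≤ m → OnRim a → σ^ i a ≡ a + i ⊎ σ^ i a + m ≡ a + i
  σ^-closed zero {a} _ _ = inj₁ (sym (+-identityʳ a))
  σ^-closed (suc i) {a} i<m ra@(_ , a≤m) with σ^ i a ≟ m | σ^-closed i (<⇒≤ i<m) ra
  ... | yes s≡m | inj₁ s≡a+i = inj₂ (begin
          σ (σ^ i a) + m ≡⟨ cong (λ s → σ s + m) s≡m ⟩
          σ m + m        ≡⟨ cong (_+ m) σ-last ⟩
          suc m          ≡⟨ cong suc (trans (sym s≡m) s≡a+i) ⟩
          suc (a + i)    ≡⟨ sym (+-suc a i) ⟩
          a + suc i      ∎)
  ... | yes s≡m | inj₂ wraps = contradiction (trans (cong (_+ m) (sym s≡m)) wraps) (<⇒≢ (+-mono-≤-< a≤m i<m) ∘ sym)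
  ... | no s≢m | inj₁ s≡a+i = inj₁ (trans (σ-other s≢m) (trans (cong suc s≡a+i) (sym (+-suc a i))))
  ... | no s≢m | inj₂ wraps = inj₂ (trans (cong (_+ m) (σ-other s≢m)) (trans (cong suc wraps) (sym (+-suc a i))))

  wrap-mismatch : ∀ {a i j s} → s ≡ a + i → s + m ≡ a + j → j < m → ⊥
  wrap-mismatch {a} {i} {j} {s} s≡a+i wraps j<m =
    <⇒≱ j<m (subst (m ≤_) (+-cancelˡ-≡ a (i + m) j (trans (sym (+-assoc a i m)) (trans (cong (_+ m) (sym s≡a+i)) wraps)))
                          (m≤n+m m i))

  σ^-injective : ∀ {i j a} → i < m → j < m → OnRim a → σ^ i a ≡ σ^ j a → i ≡ j
  σ^-injective {i} {j} {a} i<m j<m ra e with σ^-closed i (<⇒≤ i<m) ra | σ^-closed j (<⇒≤ j<m) ra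
  ... | inj₁ p | inj₁ q = +-cancelˡ-≡ a i j (trans (sym p) (trans e q))
  ... | inj₁ p | inj₂ q = ⊥-elim (wrap-mismatch (trans (sym e) p) q j<m)
  ... | inj₂ p | inj₁ q = ⊥-elim (wrap-mismatch (trans e q) p i<m)
  ... | inj₂ p | inj₂ q = +-cancelˡ-≡ a i j (trans (sym p) (trans (cong (_+ m) e) q))

  σ^-period : ∀ {a} → OnRim a → σ^ m a ≡ a
  σ^-period {a} ra@(1≤a , _) with σ^-closed m ≤-refl ra
  ... | inj₁ s≡a+m = contradiction (subst (_≤ m) s≡a+m (proj₂ (σ^-rim m ra))) (<⇒≱ (+-monoˡ-≤ m 1≤a))
  ... | inj₂ wraps = +-cancelʳ-≡ m (σ^ m a) a wraps

  -- The cyclic predecessor, m - 1 steps forward.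
  π : ℕ → ℕ
  π a = σ^ (m ∸ 1) a

  σ-π : ∀ {a} → OnRim a → σ (π a) ≡ a
  σ-π {a} ra@(1≤a , a≤m) = trans (cong (λ i → σ^ i a) (m+[n∸m]≡n (≤-trans 1≤a a≤m))) (σ^-period ra)

  infix 4 _∼_
  _∼_ : ℕ → ℕ → Set
  a ∼ b = b ≡ σ a ⊎ a ≡ σ b

  ∼-sym : ∀ {a b} → a ∼ b → b ∼ a
  ∼-sym (inj₁ e) = inj₂ e
  ∼-sym (inj₂ e) = inj₁ e

  _∼?_ : ∀ a b → Dec (a ∼ b)
  a ∼? b = (b ≟ σ a) ⊎-dec (a ≟ σ b)

  σ-cycAdj : ∀ a → cycAdj (suc m) a (σ a) ≡ true
  σ-cycAdj a with a ≟ m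
  ... | yes refl rewrite σ-last | ≡ᵇ-refl m =
    ∨-trueʳ (suc m ≡ᵇ 1) (∨-trueʳ (2 ≡ᵇ m) (∨-trueʳ ((m ≡ᵇ 1) ∧ (1 ≡ᵇ m)) refl))
  ... | no a≢m rewrite σ-other a≢m | ≡ᵇ-refl (suc a) = refl

  cycAdj-sym : ∀ a b → cycAdj (suc m) a b ≡ cycAdj (suc m) b a
  cycAdj-sym a b = trans (∨-swap (suc a ≡ᵇ b) (suc b ≡ᵇ a) _)
                         (cong (λ r → (suc b ≡ᵇ a) ∨ (suc a ≡ᵇ b) ∨ r) (∨-comm ((a ≡ᵇ 1) ∧ (b ≡ᵇ m)) _))

  ∼⇒cycAdj : ∀ {a b} → a ∼ b → cycAdj (suc m) a b ≡ true
  ∼⇒cycAdj {a}     (inj₁ refl) = σ-cycAdj a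
  ∼⇒cycAdj {b = b} (inj₂ refl) = trans (cycAdj-sym (σ b) b) (σ-cycAdj b)

  cycAdj⇒∼ : ∀ {a b} → OnRim a → OnRim b → cycAdj (suc m) a b ≡ true → a ∼ b
  cycAdj⇒∼ {a} {b} (_ , a≤m) (_ , b≤m) adj = cases (Equivalence.from T-≡ adj)
    where
    successor : ∀ {x y} → suc x ≡ y → y ≤ m → y ≡ σ x
    successor {x} refl y≤m = sym (σ-other λ { refl → <-irrefl refl y≤m })

    wrap : ∀ {x y} → T (x ≡ᵇ 1) → T (y ≡ᵇ m) → x ≡ σ y
    wrap {x} {y} x≡1 y≡m = trans (≡ᵇ⇒≡ x 1 x≡1) (sym (trans (cong σ (≡ᵇ⇒≡ y m y≡m)) σ-last))

    cases : T (cycAdj (suc m) a b) → a ∼ b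
    cases t with Equivalence.to T-∨ t
    ... | inj₁ fwd = inj₁ (successor (≡ᵇ⇒≡ (suc a) b fwd) b≤m)
    ... | inj₂ t′ with Equivalence.to T-∨ t′
    ...   | inj₁ bwd = inj₂ (successor (≡ᵇ⇒≡ (suc b) a bwd) a≤m)
    ...   | inj₂ t″ with Equivalence.to T-∨ t″
    ...     | inj₁ a1∧bm = inj₂ (wrap (proj₁ (Equivalence.to T-∧ a1∧bm)) (proj₂ (Equivalence.to T-∧ a1∧bm)))
    ...     | inj₂ b1∧am = inj₁ (wrap (proj₁ (Equivalence.to T-∧ b1∧am)) (proj₂ (Equivalence.to T-∧ b1∧am)))

  δ-adjacent : ∀ {a b} → OnRim a → OnRim b → a ≢ b → a ∼ b → δ (suc m) a b ≡ 1
  δ-adjacent ra rb a≢b a∼b = trans (δ-rim (suc m) (rim≢hub ra) (rim≢hub rb) a≢b) (cong (λ c → if c then 1 else 2) (∼⇒cycAdj a∼b))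

  δ-apart : ∀ {a b} → OnRim a → OnRim b → a ≢ b → ¬ a ∼ b → δ (suc m) a b ≡ 2
  δ-apart {a} {b} ra rb a≢b a≁b = trans (δ-rim (suc m) (rim≢hub ra) (rim≢hub rb) a≢b) (cong (λ c → if c then 1 else 2) not-adj)
    where
    not-adj : cycAdj (suc m) a b ≡ false
    not-adj with cycAdj (suc m) a b in adj
    ... | true  = contradiction (cycAdj⇒∼ ra rb adj) a≁b
    ... | false = refl

  separates⇒adjacent : ∀ {a b t} → OnRim a → OnRim b → OnRim t → a ≢ t → b ≢ t →
                       Separates (suc m) a b t → a ∼ t ⊎ b ∼ t
  separates⇒adjacent {a} {b} {t} ra rb rt a≢t b≢t sep with a ∼? t | b ∼? t
  ... | yes a∼t | _ = inj₁ a∼t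
  ... | no _ | yes b∼t = inj₂ b∼t
  ... | no a≁t | no b≁t = contradiction (trans (δ-apart ra rt a≢t a≁t) (sym (δ-apart rb rt b≢t b≁t))) sep

  adjacent⇒separates : ∀ {a b t} → OnRim a → OnRim b → OnRim t → a ≢ t → b ≢ t →
                       a ∼ t → ¬ b ∼ t → Separates (suc m) a b t
  adjacent⇒separates ra rb rt a≢t b≢t a∼t b≁t e =
    contradiction (trans (sym (δ-adjacent ra rt a≢t a∼t)) (trans e (δ-apart rb rt b≢t b≁t))) λ ()

  separates-from-hub : ∀ {b t} → OnRim b → OnRim t → b ≢ t → ¬ b ∼ t → Separates (suc m) 0 b t
  separates-from-hub rb rt b≢t b≁t e =
    contradiction (trans (sym (δ-from-hub (suc m) (rim≢hub rt))) (trans e (δ-apart rb rt b≢t b≁t))) λ ()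

  σ^-distinct : ∀ {i j a} → i < m → j < m → OnRim a → i ≢ j → σ^ i a ≢ σ^ j a
  σ^-distinct i<m j<m ra i≢j = i≢j ∘ σ^-injective i<m j<m ra

  shorter : ∀ {i} → suc i < m → i < m
  shorter = <-trans (n<1+n _)

  not-adjacent-σ^ : ∀ {i a} → OnRim a → 1 < i → suc i < m → ¬ a ∼ σ^ i a
  not-adjacent-σ^ ra 1<i 1+i<m (inj₁ σ^ia≡σa) =
    <⇒≢ 1<i (sym (σ^-injective (shorter 1+i<m) (<-trans 1<i (shorter 1+i<m)) ra σ^ia≡σa))
  not-adjacent-σ^ ra 1<i 1+i<m (inj₂ a≡σ^1+ia) =
    0≢1+n (σ^-injective (≤-trans (s≤s z≤n) 1+i<m) 1+i<m ra a≡σ^1+ia)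

  not-adjacent-π : ∀ {i a} → OnRim a → 0 < i → suc (suc i) < m → ¬ σ^ i a ∼ π a
  not-adjacent-π {i} ra@(1≤a , a≤m) 0<i 2+i<m (inj₁ πa≡σ^1+ia) =
    <-irrefl (trans (cong suc (sym (σ^-injective pred<m (shorter 2+i<m) ra πa≡σ^1+ia))) 1+[m∸1]≡m) 2+i<m
    where
    1+[m∸1]≡m : suc (m ∸ 1) ≡ m
    1+[m∸1]≡m = m+[n∸m]≡n (≤-trans 1≤a a≤m)
    pred<m : m ∸ 1 < m
    pred<m = subst (m ∸ 1 <_) 1+[m∸1]≡m (n<1+n (m ∸ 1))
  not-adjacent-π ra 0<i 2+i<m (inj₂ σ^ia≡σπa) =
    <⇒≢ 0<i (sym (σ^-injective (shorter (shorter 2+i<m)) (<-trans 0<i (shorter (shorter 2+i<m))) ra (trans σ^ia≡σπa (σ-π ra))))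

  edge-separators : ∀ {a t} → OnRim a → t ≤ m → Separates (suc m) a (σ a) t →
                    t ∈ₗ a ∷ σ a ∷ π a ∷ σ (σ a) ∷ []
  edge-separators {a} {t} ra t≤m sep with t ≟ a | t ≟ σ a | t ≟ 0
  ... | yes t≡a | _        | _        = here t≡a
  ... | no _    | yes t≡σa | _        = there (here t≡σa)
  ... | no _    | no _     | yes refl = contradiction sep (hub-separates-no-rim-pair (suc m) (rim≢hub ra) (rim≢hub (σ-rim ra)))
  ... | no t≢a  | no t≢σa  | no t≢0
      with separates⇒adjacent ra (σ-rim ra) (rim-index t≢0 t≤m) (t≢a ∘ sym) (t≢σa ∘ sym) sep
  ...   | inj₁ (inj₁ t≡σa)  = contradiction t≡σa t≢σa
  ...   | inj₁ (inj₂ a≡σt)  = there (there (here (σ-injective (rim-index t≢0 t≤m) (σ^-rim (m ∸ 1) ra) (trans (sym a≡σt) (sym (σ-π ra))))))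
  ...   | inj₂ (inj₁ t≡σσa) = there (there (there (here t≡σσa)))
  ...   | inj₂ (inj₂ σa≡σt) = contradiction (σ-injective ra (rim-index t≢0 t≤m) σa≡σt) (t≢a ∘ sym)

  record Separators (Allowed : ℕ → Set) (a b : ℕ) : Set where
    field
      witnesses  : List ℕ
      four       : length witnesses ≡ 4
      distinct   : AllPairs _≢_ witnesses
      allowed    : All Allowed witnesses
      separating : All (Separates (suc m) a b) witnesses

  flip : ∀ {P a b} → Separators P a b → Separators P b a
  flip {a = a} {b} s = record { Separators s; separating = All.map (separates-sym {suc m} {a} {b}) (Separators.separating s) }

  weaken : ∀ {P Q a b} → (∀ {t} → P t → Q t) → Separators P a b → Separators Q a b
  weaken P⇒Q s = record { Separators s; allowed = All.map P⇒Q (Separators.allowed s) }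

module LargeRim (j : ℕ) where

  open Rim (5 + j)

  -- The exponents 0 … 4 and m - 1 = 4 + j of the iterates used below are below m = 5 + j;
  -- distinct exponents then give distinct vertices by σ^-distinct.
  small : ∀ i → {T (i <ᵇ 5)} → i < 5 + j
  small i {i<5} = ≤-trans (<ᵇ⇒< i 5 i<5) (m≤m+n 5 j)

  last : 4 + j < 5 + j
  last = ≤-refl

  edge : ∀ {a} → OnRim a → Separators OnRim a (σ a)
  edge {a} ra = record
    { witnesses  = a ∷ σ a ∷ π a ∷ σ (σ a) ∷ []
    ; four       = refl
    ; distinct   = (a≢σa ∷ a≢πa ∷ a≢σσa ∷ []) ∷ (σa≢πa ∷ σa≢σσa ∷ []) ∷ (πa≢σσa ∷ []) ∷ [] ∷ []
    ; allowed    = ra ∷ σ^-rim 1 ra ∷ σ^-rim (4 + j) ra ∷ σ^-rim 2 ra ∷ []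
    ; separating = separates-self (6 + j) a≢σa ∷ separates-selfʳ (6 + j) a≢σa
                 ∷ adjacent⇒separates ra (σ^-rim 1 ra) (σ^-rim (4 + j) ra) a≢πa σa≢πa
                     (inj₂ (sym (σ-π ra))) (not-adjacent-π {1} ra (s≤s z≤n) (small 3))
                 ∷ separates-sym {6 + j} {σ a} {a} (adjacent⇒separates (σ^-rim 1 ra) ra (σ^-rim 2 ra) σa≢σσa a≢σσa
                     (inj₁ refl) (not-adjacent-σ^ {2} ra (s≤s (s≤s z≤n)) (small 3)))
                 ∷ [] }
    where
    a≢σa : a ≢ σ a
    a≢σa = σ^-distinct (small 0) (small 1) ra λ ()
    a≢πa : a ≢ π a
    a≢πa = σ^-distinct (small 0) last ra λ ()
    a≢σσa : a ≢ σ (σ a)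
    a≢σσa = σ^-distinct (small 0) (small 2) ra λ ()
    σa≢πa : σ a ≢ π a
    σa≢πa = σ^-distinct (small 1) last ra λ ()
    σa≢σσa : σ a ≢ σ (σ a)
    σa≢σσa = σ^-distinct (small 1) (small 2) ra λ ()
    πa≢σσa : π a ≢ σ (σ a)
    πa≢σσa = σ^-distinct last (small 2) ra λ ()

  two-apart : ∀ {a} → OnRim a → Separators OnRim a (σ (σ a))
  two-apart {a} ra = record
    { witnesses  = a ∷ σ (σ a) ∷ π a ∷ σ^ 3 a ∷ []
    ; four       = refl
    ; distinct   = (a≢σσa ∷ a≢πa ∷ a≢σ³a ∷ []) ∷ (σσa≢πa ∷ σσa≢σ³a ∷ []) ∷ (πa≢σ³a ∷ []) ∷ [] ∷ []
    ; allowed    = ra ∷ σ^-rim 2 ra ∷ σ^-rim (4 + j) ra ∷ σ^-rim 3 ra ∷ []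
    ; separating = separates-self (6 + j) a≢σσa ∷ separates-selfʳ (6 + j) a≢σσa
                 ∷ adjacent⇒separates ra (σ^-rim 2 ra) (σ^-rim (4 + j) ra) a≢πa σσa≢πa
                     (inj₂ (sym (σ-π ra))) (not-adjacent-π {2} ra (s≤s z≤n) (small 4))
                 ∷ separates-sym {6 + j} {σ (σ a)} {a} (adjacent⇒separates (σ^-rim 2 ra) ra (σ^-rim 3 ra) σσa≢σ³a a≢σ³a
                     (inj₁ refl) (not-adjacent-σ^ {3} ra (s≤s (s≤s z≤n)) (small 4)))
                 ∷ [] }
    where
    a≢σσa : a ≢ σ (σ a)
    a≢σσa = σ^-distinct (small 0) (small 2) ra λ ()
    a≢πa : a ≢ π a
    a≢πa = σ^-distinct (small 0) last ra λ ()
    a≢σ³a : a ≢ σ^ 3 a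
    a≢σ³a = σ^-distinct (small 0) (small 3) ra λ ()
    σσa≢πa : σ (σ a) ≢ π a
    σσa≢πa = σ^-distinct (small 2) last ra λ ()
    σσa≢σ³a : σ (σ a) ≢ σ^ 3 a
    σσa≢σ³a = σ^-distinct (small 2) (small 3) ra λ ()
    πa≢σ³a : π a ≢ σ^ 3 a
    πa≢σ³a = σ^-distinct last (small 3) ra λ ()

  far-apart : ∀ {a b} → OnRim a → OnRim b → a ≢ b → ¬ a ∼ b → ¬ σ a ∼ b → ¬ π a ∼ b → Separators OnRim a b
  far-apart {a} {b} ra rb a≢b a≁b σa≁b πa≁b = record
    { witnesses  = a ∷ b ∷ σ a ∷ π a ∷ []
    ; four       = refl
    ; distinct   = (a≢b ∷ a≢σa ∷ a≢πa ∷ []) ∷ (b≢σa ∷ b≢πa ∷ []) ∷ (σa≢πa ∷ []) ∷ [] ∷ []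
    ; allowed    = ra ∷ rb ∷ σ^-rim 1 ra ∷ σ^-rim (4 + j) ra ∷ []
    ; separating = separates-self (6 + j) a≢b ∷ separates-selfʳ (6 + j) a≢b
                 ∷ adjacent⇒separates ra rb (σ^-rim 1 ra) a≢σa b≢σa (inj₁ refl) (σa≁b ∘ ∼-sym)
                 ∷ adjacent⇒separates ra rb (σ^-rim (4 + j) ra) a≢πa b≢πa (inj₂ (sym (σ-π ra))) (πa≁b ∘ ∼-sym)
                 ∷ [] }
    where
    a≢σa : a ≢ σ a
    a≢σa = σ^-distinct (small 0) (small 1) ra λ ()
    a≢πa : a ≢ π a
    a≢πa = σ^-distinct (small 0) last ra λ ()
    σa≢πa : σ a ≢ π a
    σa≢πa = σ^-distinct (small 1) last ra λ ()
    b≢σa : b ≢ σ a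
    b≢σa b≡σa = a≁b (inj₁ b≡σa)
    b≢πa : b ≢ π a
    b≢πa b≡πa = a≁b (inj₂ (trans (sym (σ-π ra)) (cong σ (sym b≡πa))))

  rim-pair : ∀ {a b} → OnRim a → OnRim b → a ≢ b → Separators OnRim a b
  rim-pair {a} {b} ra rb a≢b with a ∼? b
  ... | yes (inj₁ refl) = edge ra
  ... | yes (inj₂ refl) = flip (edge rb)
  ... | no a≁b with σ a ∼? b
  ...   | yes (inj₁ refl)   = two-apart ra
  ...   | yes (inj₂ σa≡σb)  = contradiction (σ-injective ra rb σa≡σb) a≢b
  ...   | no σa≁b with π a ∼? b
  ...     | yes (inj₁ b≡σπa) = contradiction (trans (sym (σ-π ra)) (sym b≡σπa)) a≢b
  ...     | yes (inj₂ πa≡σb) = subst (λ x → Separators OnRim x b) (trans (cong σ (sym πa≡σb)) (σ-π ra)) (flip (two-apart rb))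
  ...     | no πa≁b = far-apart ra rb a≢b a≁b σa≁b πa≁b

  hub-pair : ∀ {b} → OnRim b → Separators (_≤ 5 + j) 0 b
  hub-pair {b} rb = record
    { witnesses  = 0 ∷ b ∷ σ (σ b) ∷ σ^ 3 b ∷ []
    ; four       = refl
    ; distinct   = (0≢b ∷ 0≢ rb2 ∷ 0≢ rb3 ∷ []) ∷ (b≢σσb ∷ b≢σ³b ∷ []) ∷ (σσb≢σ³b ∷ []) ∷ [] ∷ []
    ; allowed    = z≤n ∷ proj₂ rb ∷ proj₂ rb2 ∷ proj₂ rb3 ∷ []
    ; separating = separates-self (6 + j) 0≢b ∷ separates-selfʳ (6 + j) 0≢b
                 ∷ separates-from-hub rb rb2 b≢σσb (not-adjacent-σ^ {2} rb (s≤s (s≤s z≤n)) (small 3))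
                 ∷ separates-from-hub rb rb3 b≢σ³b (not-adjacent-σ^ {3} rb (s≤s (s≤s z≤n)) (small 4))
                 ∷ [] }
    where
    rb2 : OnRim (σ (σ b))
    rb2 = σ^-rim 2 rb
    rb3 : OnRim (σ^ 3 b)
    rb3 = σ^-rim 3 rb
    0≢ : ∀ {t} → OnRim t → 0 ≢ t
    0≢ rt = rim≢hub rt ∘ sym
    0≢b : 0 ≢ b
    0≢b = 0≢ rb
    b≢σσb : b ≢ σ (σ b)
    b≢σσb = σ^-distinct (small 0) (small 2) rb λ ()
    b≢σ³b : b ≢ σ^ 3 b
    b≢σ³b = σ^-distinct (small 0) (small 3) rb λ ()
    σσb≢σ³b : σ (σ b) ≢ σ^ 3 b
    σσb≢σ³b = σ^-distinct (small 2) (small 3) rb λ ()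

  hub-pair-on-rim : 1 ≤ j → ∀ {b} → OnRim b → Separators OnRim 0 b
  hub-pair-on-rim 1≤j {b} rb = record
    { witnesses  = b ∷ σ (σ b) ∷ σ^ 3 b ∷ σ^ 4 b ∷ []
    ; four       = refl
    ; distinct   = (b≢σσb ∷ b≢σ³b ∷ b≢σ⁴b ∷ []) ∷ (σσb≢σ³b ∷ σσb≢σ⁴b ∷ []) ∷ (σ³b≢σ⁴b ∷ []) ∷ [] ∷ []
    ; allowed    = rb ∷ σ^-rim 2 rb ∷ σ^-rim 3 rb ∷ σ^-rim 4 rb ∷ []
    ; separating = separates-selfʳ (6 + j) (rim≢hub rb ∘ sym)
                 ∷ separates-from-hub rb (σ^-rim 2 rb) b≢σσb (not-adjacent-σ^ {2} rb (s≤s (s≤s z≤n)) (small 3))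
                 ∷ separates-from-hub rb (σ^-rim 3 rb) b≢σ³b (not-adjacent-σ^ {3} rb (s≤s (s≤s z≤n)) (small 4))
                 ∷ separates-from-hub rb (σ^-rim 4 rb) b≢σ⁴b (not-adjacent-σ^ {4} rb (s≤s (s≤s z≤n)) 5<m)
                 ∷ [] }
    where
    5<m : 5 < 5 + j
    5<m = +-monoʳ-≤ 5 1≤j
    b≢σσb : b ≢ σ (σ b)
    b≢σσb = σ^-distinct (small 0) (small 2) rb λ ()
    b≢σ³b : b ≢ σ^ 3 b
    b≢σ³b = σ^-distinct (small 0) (small 3) rb λ ()
    b≢σ⁴b : b ≢ σ^ 4 b
    b≢σ⁴b = σ^-distinct (small 0) (small 4) rb λ ()
    σσb≢σ³b : σ (σ b) ≢ σ^ 3 b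
    σσb≢σ³b = σ^-distinct (small 2) (small 3) rb λ ()
    σσb≢σ⁴b : σ (σ b) ≢ σ^ 4 b
    σσb≢σ⁴b = σ^-distinct (small 2) (small 4) rb λ ()
    σ³b≢σ⁴b : σ^ 3 b ≢ σ^ 4 b
    σ³b≢σ⁴b = σ^-distinct (small 3) (small 4) rb λ ()

module Landmarks (j : ℕ) where

  open Rim (5 + j)
  open LargeRim j

  vertex : ∀ {t} → t ≤ 5 + j → Fin (6 + j)
  vertex t≤m = fromℕ< (s≤s t≤m)

  toℕ-vertex : ∀ {t} (t≤m : t ≤ 5 + j) → toℕ (vertex t≤m) ≡ t
  toℕ-vertex t≤m = toℕ-fromℕ< (s≤s t≤m)

  rim-of : ∀ {τ : Fin (6 + j)} → toℕ τ ≢ 0 → OnRim (toℕ τ)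
  rim-of {τ} τ≢0 = rim-index τ≢0 (≤-pred (toℕ<n τ))

  ∈cycleSet⁺ : ∀ {τ : Fin (6 + j)} → toℕ τ ≢ 0 → τ ∈ cycleSet (6 + j)
  ∈cycleSet⁺ {τ} τ≢0 = lookup⇒[]= τ _ (trans (lookup∘tabulate (λ x → not (isHub x)) τ) (cong not (≡ᵇ-false τ≢0)))

  ∈cycleSet⁻ : ∀ {τ : Fin (6 + j)} → τ ∈ cycleSet (6 + j) → toℕ τ ≢ 0
  ∈cycleSet⁻ {τ} τ∈C τ≡0 = not-rim (trans (sym (lookup∘tabulate (λ x → not (isHub x)) τ)) ([]=⇒lookup τ∈C))
    where
    not-rim : not (isHub τ) ≢ true
    not-rim rewrite τ≡0 = λ ()

  rim-named : ∀ {t} → OnRim t → Named (cycleSet (6 + j)) t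
  rim-named rt = vertex (proj₂ rt) , toℕ-vertex (proj₂ rt)
               , ∈cycleSet⁺ (subst (_≢ 0) (sym (toℕ-vertex (proj₂ rt))) (rim≢hub rt))

  vertex-named : ∀ {t} → t ≤ 5 + j → Named ⊤ t
  vertex-named t≤m = vertex t≤m , toℕ-vertex t≤m , ∈⊤ {x = vertex t≤m}

  four-separators : ∀ {P} L → (∀ {t} → P t → Named L t) → ∀ {u v} →
          Separators P (toℕ u) (toℕ v) → 4 ≤ ∣ L ∩ sepSet (6 + j) u v ∣
  four-separators {P} L named {u} {v} s = subst (_≤ ∣ L ∩ sepSet (6 + j) u v ∣) four
    (length≤∣p∣ (L ∩ sepSet (6 + j) u v) distinct (All.zipWith (λ (p , sep) → in-both (named p) sep) (allowed , separating)))
    where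
    open Separators s
    in-both : ∀ {t} → Named L t → Separates (6 + j) (toℕ u) (toℕ v) t → Named (L ∩ sepSet (6 + j) u v) t
    in-both (τ , refl , τ∈L) sep = τ , refl , x∈p∩q⁺ (τ∈L , ∈sepSet⁺ u v sep)

  all-pairs : ∀ {P} → (∀ {b} → OnRim b → Separators P 0 b) →
              (∀ {a b} → OnRim a → OnRim b → a ≢ b → Separators P a b) →
              ∀ (u v : Fin (6 + j)) → u ≢ v → Separators P (toℕ u) (toℕ v)
  all-pairs {P} hub rim u v u≢v with toℕ u ≟ 0 | toℕ v ≟ 0
  ... | yes u≡0 | yes v≡0 = contradiction (toℕ-injective (trans u≡0 (sym v≡0))) u≢v
  ... | yes u≡0 | no v≢0  = subst (λ a → Separators P a (toℕ v)) (sym u≡0) (hub (rim-of v≢0))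
  ... | no u≢0  | yes v≡0 = subst (Separators P (toℕ u)) (sym v≡0) (flip (hub (rim-of u≢0)))
  ... | no u≢0  | no v≢0  = rim (rim-of u≢0) (rim-of v≢0) (u≢v ∘ toℕ-injective)

  landmark : ∀ {P} L → (∀ {t} → P t → Named L t) →
             (∀ {b} → OnRim b → Separators P 0 b) →
             (∀ {a b} → OnRim a → OnRim b → a ≢ b → Separators P a b) →
             IsAPLandmark (6 + j) 4 L
  landmark L named hub rim u v u≢v = four-separators L named (all-pairs hub rim u v u≢v)

  cycle-landmark : 1 ≤ j → IsAPLandmark (6 + j) 4 (cycleSet (6 + j))
  cycle-landmark 1≤j = landmark (cycleSet (6 + j)) rim-named (hub-pair-on-rim 1≤j) rim-pair

  full-landmark : IsAPLandmark (6 + j) 4 ⊤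
  full-landmark = landmark ⊤ vertex-named hub-pair (λ ra rb a≢b → weaken proj₂ (rim-pair ra rb a≢b))

  successor : ∀ {u : Fin (6 + j)} → OnRim (toℕ u) → Fin (6 + j)
  successor ru = vertex (proj₂ (σ-rim ru))

  successor-distinct : ∀ {u} (ru : OnRim (toℕ u)) → u ≢ successor ru
  successor-distinct ru u≡v = σ^-distinct (small 0) (small 1) ru (λ ()) (trans (cong toℕ u≡v) (toℕ-vertex (proj₂ (σ-rim ru))))

  edge-separated : ∀ {u} (ru : OnRim (toℕ u)) {τ} → τ ∈ sepSet (6 + j) u (successor ru) →
                   toℕ τ ∈ₗ toℕ u ∷ σ (toℕ u) ∷ π (toℕ u) ∷ σ (σ (toℕ u)) ∷ []
  edge-separated {u} ru {τ} τ∈ = edge-separators ru (≤-pred (toℕ<n τ))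
    (subst (λ b → Separates (6 + j) (toℕ u) b (toℕ τ)) (toℕ-vertex (proj₂ (σ-rim ru))) (∈sepSet⁻ u (successor ru) τ∈))

  -- md_k = ∞ for k ≥ 5: the edge c₁c₂ has only four separators.
  no-landmark : ∀ {k L} → 5 ≤ k → ¬ IsAPLandmark (6 + j) k L
  no-landmark {L = L} 5≤k isL =
    <-irrefl refl (≤-trans 5≤k (landmark-bound {L = L} _ isL (successor-distinct rc₁) (edge-separated rc₁)))
    where
    rc₁ : OnRim (toℕ {6 + j} (fsuc fzero))
    rc₁ = ≤-refl , s≤s z≤n

  cycle-forced : ∀ {L} → IsAPLandmark (6 + j) 4 L → cycleSet (6 + j) ⊆ L
  cycle-forced {L} isL {τ} τ∈C = forced {L = L} τ _ isL (successor-distinct rτ) (edge-separated rτ)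
    where
    rτ : OnRim (toℕ τ)
    rτ = rim-of (∈cycleSet⁻ τ∈C)

-- In the wheel on six vertices the hub and c₁ are separated exactly by h, c₁, c₃ and c₄
-- (c₂ and c₅ are adjacent to both), so the hub lies in every 4-landmark set.
hub-c₁-separators : sepSet 6 fzero (fsuc fzero) ≡ inside ∷ inside ∷ outside ∷ inside ∷ inside ∷ outside ∷ []
hub-c₁-separators = refl

hub-forced : ∀ {L} → IsAPLandmark 6 4 L → fzero ∈ L
hub-forced isL = forced {u = fzero} {fsuc fzero} fzero (1 ∷ 3 ∷ 4 ∷ []) isL (λ ())
                   (λ {τ} τ∈ → members (subst (τ ∈_) hub-c₁-separators τ∈))
  where
  members : ∀ {τ} → τ ∈ inside ∷ inside ∷ outside ∷ inside ∷ inside ∷ outside ∷ [] → toℕ τ ∈ₗ 0 ∷ 1 ∷ 3 ∷ 4 ∷ []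
  members here                                = here refl
  members (there here)                        = there (here refl)
  members (there (there (there here)))        = there (there (here refl))
  members (there (there (there (there here)))) = there (there (there (here refl)))
  members (there (there (there (there (there (there ()))))))

mainTheorem10 : (n : ℕ) → 6 ≤ n → (w : Fin n → ℚ) → ((v : Fin n) → Positive (w v)) →
    ((k : ℕ) → 5 ≤ k → MdInfinite n k)
    × (7 ≤ n → MdEquals n 4 (n ∸ 1) × WmdEquals n w 4 (weight w (cycleSet n)))
    × (n ≡ 6 → MdEquals n 4 6 × WmdEquals n w 4 (weight w ⊤))
mainTheorem10 _ (s≤s (s≤s (s≤s (s≤s (s≤s (s≤s (z≤n {j}))))))) w pos =
  (λ k 5≤k L → no-landmark {L = L} 5≤k) , at-least-seven , exactly-six
  where
  open Landmarks j
  at-least-seven : 7 ≤ 6 + j → MdEquals (6 + j) 4 (5 + j) × WmdEquals (6 + j) w 4 (weight w (cycleSet (6 + j)))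
  at-least-seven 7≤n = subst (λ c → MdEquals (6 + j) 4 c × WmdEquals (6 + j) w 4 (weight w (cycleSet (6 + j))))
    (∣cycleSet∣ (5 + j))
    (least-landmark w pos (cycleSet (6 + j)) (cycle-landmark (+-cancelˡ-≤ 6 1 j 7≤n)) (λ L isL → cycle-forced {L} isL))
  exactly-six : 6 + j ≡ 6 → MdEquals (6 + j) 4 6 × WmdEquals (6 + j) w 4 (weight w ⊤)
  exactly-six refl = subst (λ c → MdEquals 6 4 c × WmdEquals 6 w 4 (weight w ⊤)) (∣⊤∣≡n 6)
    (least-landmark w pos ⊤ full-landmark all-forced)
    where
    all-forced : ∀ L → IsAPLandmark 6 4 L → ⊤ ⊆ L
    all-forced L isL {fzero}  _ = hub-forced {L} isL
    all-forced L isL {fsuc τ} _ = cycle-forced {L} isL (∈cycleSet⁺ λ ())
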